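{- In the quantum variation of single-heap Nim under Ruleset A, Ruleset B or Ruleset D, the value of a superposition $\langle \mathrm{Nim}(i_1),\dots,\mathrm{Nim}(i_\ell)\rangle$ of a single Nim heap in different states depends only on the largest heap size $\max_j i_j$ in the superposition.
   Context: Nim: $\mathrm{Nim}(x_1,\dots,x_k)$ denotes the position with $k$ heaps of $x_1,\dots,x_k$ tokens; a classical move is a pair $(i,-j)$ with $j\ge1$, meaning remove $j$ tokens from heap $i$, legal iff heap $i$ has at least $j$ tokens. For a single heap, moves are $(1,-j)$. Quantum variation: a quantum position is a finite nonempty set $\langle G_1,\dots,G_n\rangle$ of classical positions (multiplicities irrelevant). A classical move $m$ is legal in it if it is legal in at least one $G_i$. A Q-move is a finite nonempty set of classical moves, each legal in the current quantum position; it leads to the set of all positions obtained by applying one of its moves to one of the $G_i$ where that move is legal. A Q-move consisting of a single classical move is unsuperposed. Ruleset A: only Q-moves with at least two distinct classical moves are allowed. Ruleset B: same, except that when the player has exactly one legal classical move in the quantum position he may play it unsuperposed. Ruleset D: all Q-moves allowed. Normal convention: a player with no allowed Q-move loses. The value of an (impartial) game is its equivalence class, where $G\equiv H$ iff $G+X$ and $H+X$ have the same outcome for every game $X$ ($+$ the disjunctive sum); values are nimbers. -}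

module Defs where

open import Data.Nat using (ℕ; zero; suc; _∸_; _⊔_; _≤ᵇ_; _≡ᵇ_)
open import Data.Bool using (Bool; true; false; not; _∨_; _∧_; if_then_else_)
open import Data.List using (List; []; _∷_; [_]; _++_; map; length; concatMap; foldr; upTo)
open import Relation.Binary.PropositionalEquality using (_≡_)

-- Short impartial games as finite game trees (a node = list of options)

data Game : Set where
  mk : List Game → Game

-- Normal convention: the player to move wins iff some option is a
-- position in which the player to move loses.
mutual
  firstWins : Game → Bool
  firstWins (mk gs) = someLoses gs

  someLoses : List Game → Bool
  someLoses []       = false
  someLoses (g ∷ gs) = not (firstWins g) ∨ someLoses gs

mutual
  infixl 6 _⊕_
  _⊕_ : Game → Game → Game
  mk gs ⊕ mk hs = mk (leftOpts gs (mk hs) ++ rightOpts (mk gs) hs)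

  leftOpts : List Game → Game → List Game
  leftOpts []       h = []
  leftOpts (g ∷ gs) h = (g ⊕ h) ∷ leftOpts gs h

  rightOpts : Game → List Game → List Game
  rightOpts g []       = []
  rightOpts g (h ∷ hs) = (g ⊕ h) ∷ rightOpts g hs

infix 4 _≈g_
_≈g_ : Game → Game → Set
G ≈g H = ∀ (X : Game) → firstWins (G ⊕ X) ≡ firstWins (H ⊕ X)

data Ruleset : Set where
  A B D : Ruleset

-- largest heap size in a quantum position (list of heap sizes)
maxL : List ℕ → ℕ
maxL = foldr _⊔_ 0

-- all sublists (as sets of distinct elements when the input is duplicate-free)
subs : {X : Set} → List X → List (List X)
subs []       = [ [] ]
subs (x ∷ xs) = map (x ∷_) (subs xs) ++ subs xs

filterB : {X : Set} → (X → Bool) → List X → List X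
filterB p []       = []
filterB p (x ∷ xs) = if p x then x ∷ filterB p xs else filterB p xs

-- legal classical moves (1,-j) in a quantum position with largest heap m:
-- exactly j = 1 .. m
legalMoves : ℕ → List ℕ
legalMoves m = map suc (upTo m)

-- which Q-moves S (nonempty sets of legal classical moves) are allowed,
-- given the largest heap m
allowed : Ruleset → ℕ → List ℕ → Bool
allowed A m S = 2 ≤ᵇ length S
allowed B m S = (2 ≤ᵇ length S) ∨ ((length S ≡ᵇ 1) ∧ (m ≡ᵇ 1))
allowed D m S = 1 ≤ᵇ length S

applyQ : List ℕ → List ℕ → List ℕ
applyQ xs S = concatMap (λ i → concatMap (λ j → if j ≤ᵇ i then [ i ∸ j ] else []) S) xs

qMoves : Ruleset → List ℕ → List (List ℕ)
qMoves r xs = filterB (allowed r (maxL xs)) (subs (legalMoves (maxL xs)))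

-- game tree, with fuel (every move strictly decreases maxL)
qGameF : Ruleset → ℕ → List ℕ → Game
qGameF r zero    xs = mk []
qGameF r (suc n) xs = mk (map (λ S → qGameF r n (applyQ xs S)) (qMoves r xs))

QGame : Ruleset → List ℕ → Game
QGame r xs = qGameF r (suc (maxL xs)) xs

-- Every ingredient of the game tree of a superposition (the legal classical
-- moves, which Q-moves are allowed, the fuel) depends on the position only
-- through its largest heap m.  The same holds for the position reached by a
-- Q-move S: the largest heap in it is the largest heap reached from m by a
-- move of S, because removing j tokens, where legal, is monotone in the heap
-- size and leaves nothing above 0 when applied to the empty heap.  Hence by induction the two game
-- trees are literally equal, and so are their values.
module Submission where

open import Defs
open import Data.Bool using (true; false; T; if_then_else_)
open import Data.Empty using (⊥-elim)
open import Data.Unit using (tt)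
open import Data.List using (List; []; _∷_; [_]; _++_; map; concatMap)
open import Data.List.Properties using (map-cong; ++-identityʳ)
open import Data.Nat using (ℕ; zero; suc; _∸_; _⊔_; _≤ᵇ_; _≤_; z≤n)
open import Data.Nat.Properties
  using (≤-trans; ≤-reflexive; ⊔-assoc; ≤ᵇ⇒≤; ≤⇒≤ᵇ; ∸-monoˡ-≤; ⊔-monoˡ-≤; ⊔-mono-≤; ⊔-lub; n≤0⇒n≡0; mono-≤-distrib-⊔)
open import Function using (_∘_)
open import Relation.Binary using (_Preserves_⟶_)
open import Relation.Binary.PropositionalEquality
  using (_≡_; _≢_; refl; cong; trans; sym; subst; module ≡-Reasoning)

maxL-++ : ∀ as bs → maxL (as ++ bs) ≡ maxL as ⊔ maxL bs
maxL-++ []       bs = refl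
maxL-++ (a ∷ as) bs = begin
  a ⊔ maxL (as ++ bs)       ≡⟨ cong (a ⊔_) (maxL-++ as bs) ⟩
  a ⊔ (maxL as ⊔ maxL bs)   ≡⟨ sym (⊔-assoc a (maxL as) (maxL bs)) ⟩
  a ⊔ maxL as ⊔ maxL bs     ∎
  where open ≡-Reasoning

module _ {X : Set} where

  maxL-concatMap-mono : {f g : X → List ℕ} → (∀ x → maxL (f x) ≤ maxL (g x)) →
    ∀ xs → maxL (concatMap f xs) ≤ maxL (concatMap g xs)
  maxL-concatMap-mono f≤g []       = z≤n
  maxL-concatMap-mono {f} {g} f≤g (x ∷ xs)
    rewrite maxL-++ (f x) (concatMap f xs) | maxL-++ (g x) (concatMap g xs) =
    ⊔-mono-≤ (f≤g x) (maxL-concatMap-mono f≤g xs)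

  maxL-concatMap-≤ : ∀ {f : X → List ℕ} {n} → (∀ x → maxL (f x) ≤ n) →
    ∀ xs → maxL (concatMap f xs) ≤ n
  maxL-concatMap-≤ f≤n []       = z≤n
  maxL-concatMap-≤ {f} f≤n (x ∷ xs) rewrite maxL-++ (f x) (concatMap f xs) =
    ⊔-lub (f≤n x) (maxL-concatMap-≤ f≤n xs)

maxL-concatMap-maxL : {f : ℕ → List ℕ} → (maxL ∘ f) Preserves _≤_ ⟶ _≤_ →
  maxL (f 0) ≡ 0 → ∀ xs → maxL (concatMap f xs) ≡ maxL (f (maxL xs))
maxL-concatMap-maxL _ f0≡0 []       = sym f0≡0
maxL-concatMap-maxL {f} mono f0≡0 (x ∷ xs) = begin
  maxL (f x ++ concatMap f xs)           ≡⟨ maxL-++ (f x) (concatMap f xs) ⟩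
  maxL (f x) ⊔ maxL (concatMap f xs)     ≡⟨ cong (maxL (f x) ⊔_) (maxL-concatMap-maxL mono f0≡0 xs) ⟩
  maxL (f x) ⊔ maxL (f (maxL xs))        ≡⟨ sym (mono-≤-distrib-⊔ mono x (maxL xs)) ⟩
  maxL (f (x ⊔ maxL xs))                 ∎
  where open ≡-Reasoning

-- Definitionally the inner function of applyQ.
removal : ℕ → ℕ → List ℕ
removal i j = if j ≤ᵇ i then [ i ∸ j ] else []

maxL-removal-mono : ∀ j → (λ i → maxL (removal i j)) Preserves _≤_ ⟶ _≤_
maxL-removal-mono j {a} {b} a≤b with j ≤ᵇ a in j≤ᵇa | j ≤ᵇ b in j≤ᵇb
... | false | _     = z≤n
... | true  | true  = ⊔-monoˡ-≤ 0 (∸-monoˡ-≤ j a≤b)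
... | true  | false = ⊥-elim (subst T j≤ᵇb (≤⇒≤ᵇ (≤-trans j≤a a≤b)))
  where j≤a : j ≤ a
        j≤a = ≤ᵇ⇒≤ j a (subst T (sym j≤ᵇa) tt)

maxL-removal-zero : ∀ j → maxL (removal 0 j) ≡ 0
maxL-removal-zero zero    = refl
maxL-removal-zero (suc j) = refl

maxL-removals-mono : ∀ S → (λ i → maxL (concatMap (removal i) S)) Preserves _≤_ ⟶ _≤_
maxL-removals-mono S a≤b = maxL-concatMap-mono (λ j → maxL-removal-mono j a≤b) S

maxL-removals-zero : ∀ S → maxL (concatMap (removal 0) S) ≡ 0
maxL-removals-zero S =
  n≤0⇒n≡0 (maxL-concatMap-≤ (λ j → ≤-reflexive (maxL-removal-zero j)) S)

maxL-applyQ : ∀ xs S → maxL (applyQ xs S) ≡ maxL (applyQ [ maxL xs ] S)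
maxL-applyQ xs S = trans
  (maxL-concatMap-maxL (maxL-removals-mono S) (maxL-removals-zero S) xs)
  (cong maxL (sym (++-identityʳ (concatMap (removal (maxL xs)) S))))

applyQ-cong-maxL : ∀ xs ys → maxL xs ≡ maxL ys →
  ∀ S → maxL (applyQ xs S) ≡ maxL (applyQ ys S)
applyQ-cong-maxL xs ys eq S = begin
  maxL (applyQ xs S)            ≡⟨ maxL-applyQ xs S ⟩
  maxL (applyQ [ maxL xs ] S)   ≡⟨ cong (λ m → maxL (applyQ [ m ] S)) eq ⟩
  maxL (applyQ [ maxL ys ] S)   ≡⟨ sym (maxL-applyQ ys S) ⟩
  maxL (applyQ ys S)            ∎
  where open ≡-Reasoning

qMoves-cong-maxL : ∀ r xs ys → maxL xs ≡ maxL ys → qMoves r xs ≡ qMoves r ys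
qMoves-cong-maxL r xs ys = cong (λ m → filterB (allowed r m) (subs (legalMoves m)))

qGameF-cong-maxL : ∀ r n xs ys → maxL xs ≡ maxL ys → qGameF r n xs ≡ qGameF r n ys
qGameF-cong-maxL r zero    xs ys eq = refl
qGameF-cong-maxL r (suc n) xs ys eq = cong mk (begin
  map (λ S → qGameF r n (applyQ xs S)) (qMoves r xs)
    ≡⟨ map-cong (λ S → qGameF-cong-maxL r n _ _ (applyQ-cong-maxL xs ys eq S)) (qMoves r xs) ⟩
  map (λ S → qGameF r n (applyQ ys S)) (qMoves r xs)
    ≡⟨ cong (map (λ S → qGameF r n (applyQ ys S))) (qMoves-cong-maxL r xs ys eq) ⟩
  map (λ S → qGameF r n (applyQ ys S)) (qMoves r ys)  ∎)
  where open ≡-Reasoning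

QGame-cong-maxL : ∀ r xs ys → maxL xs ≡ maxL ys → QGame r xs ≡ QGame r ys
QGame-cong-maxL r xs ys eq =
  trans (cong (λ m → qGameF r (suc m) xs) eq) (qGameF-cong-maxL r (suc (maxL ys)) xs ys eq)

≡⇒≈g : ∀ {G H} → G ≡ H → G ≈g H
≡⇒≈g refl X = refl

mainTheorem2 : (r : Ruleset) (xs ys : List ℕ) → xs ≢ [] → ys ≢ [] →
    maxL xs ≡ maxL ys → QGame r xs ≈g QGame r ys
mainTheorem2 r xs ys _ _ eq = ≡⇒≈g (QGame-cong-maxL r xs ys eq)
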